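{- For an integer $a\ge 0$ write the Gaussian binomial coefficient as $\binom{a+4}{4}_q=\sum_{i=0}^{4a}d_{a,i}q^i$. Define $f(a,c)=d_{a,2a-c}-d_{a,2a-c-1}$ for $c\ge 0$ (with $d_{a,i}=0$ for $i<0$), and $f(a,c)=0$ for $c<0$. Then: (a) $\displaystyle\sum_{a,c}f(a,c)q^at^c=\frac{1}{(1-q^2)(1-q^3)(1-qt^2)}+\frac{q^2t^2}{(1-q^2)(1-q^3)(1-qt^2)(1-qt)}$; (b) $f(a,c)\ge 0$ for all $a,c$; moreover, if $a\ge 2$ and $0\le c\le 2a$, then $f(a,c)=0$ if and only if $c=1$, or $c=2a-1$, or $(a,c)=(4,3)$; (c) $f(a,0)=\lfloor (a+3\delta)/6\rfloor$, where $\delta=1$ if $a$ is odd and $\delta=2$ if $a$ is even; in particular $f(a,0)\to\infty$ as $a\to\infty$.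
   Context: $\binom{a+4}{4}_q=\prod_{j=1}^{4}\frac{1-q^{a+j}}{1-q^{j}}$ is the Gaussian ($q$-binomial) coefficient, i.e. the rank-generating function of partitions with at most $4$ parts and largest part at most $a$. -}

module Defs where

open import Data.Nat as ℕ using (ℕ; zero; suc; _∸_; _≡ᵇ_)
open import Data.Nat.DivMod using (_%_)
open import Data.Integer as ℤ using (ℤ; +_; -[1+_])
open import Data.List using (List; []; _∷_; [_]; map; concatMap; upTo; filterᵇ; length; foldr)
open import Data.Nat.ListAction renaming (sum to sumℕ)
open import Data.Bool using (Bool; true; false; if_then_else_; _∧_)

-- Weakly decreasing lists (x₁ ≥ x₂ ≥ … ≥ x_k) of length k with entries ≤ m,
-- i.e. partitions with at most k parts (zeros padded) and largest part ≤ m.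
boxPartitions : ℕ → ℕ → List (List ℕ)
boxPartitions zero    m = [ [] ]
boxPartitions (suc k) m =
  concatMap (λ x → map (x ∷_) (boxPartitions k x)) (upTo (suc m))

-- d a i = coefficient of q^i in the Gaussian binomial [a+4 choose 4]_q
--       = number of partitions of i with at most 4 parts, largest part ≤ a.
d : ℕ → ℕ → ℕ
d a i = length (filterᵇ (λ p → sumℕ p ≡ᵇ i) (boxPartitions 4 a))

dℤ : ℕ → ℤ → ℤ
dℤ a (+ i)    = + d a i
dℤ a -[1+ _ ] = + 0

f : ℕ → ℤ → ℤ
f a (+ c)    = dℤ a (+ (2 ℕ.* a) ℤ.- + c) ℤ.- dℤ a (+ (2 ℕ.* a) ℤ.- + c ℤ.- + 1)
f a -[1+ _ ] = + 0

-- Formal power series in q, t with integer coefficients: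
-- F a c is the coefficient of q^a t^c.
Series : Set
Series = ℕ → ℕ → ℤ

sumℤ : List ℤ → ℤ
sumℤ = foldr ℤ._+_ (+ 0)

_⊛_ : Series → Series → Series
(F ⊛ G) a c = sumℤ (concatMap (λ i → map (λ j → F i j ℤ.* G (a ∸ i) (c ∸ j)) (upTo (suc c))) (upTo (suc a)))

infixl 7 _⊛_

mono : ℕ → ℕ → Series
mono i j a c = if (a ≡ᵇ i) ∧ (c ≡ᵇ j) then + 1 else + 0

-- 1/(1 - q^(suc i) t^j) = Σ_k q^(k(i+1)) t^(kj)  (i+1 ≥ 1, so k ≤ a is enough)
geom : ℕ → ℕ → Series
geom i j a c = sumℤ (map (λ k → mono (k ℕ.* suc i) (k ℕ.* j) a c) (upTo (suc a)))

fSeries : Series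
fSeries a c = f a (+ c)

rhsA : Series
rhsA a c = (geom 1 0 ⊛ geom 2 0 ⊛ geom 0 2) a c
     ℤ.+ (mono 2 2 ⊛ geom 1 0 ⊛ geom 2 0 ⊛ geom 0 2 ⊛ geom 0 1) a c

δ : ℕ → ℕ
δ a = if a % 2 ≡ᵇ 1 then 1 else 2

-- Both sides of (a) are computed in closed form and compared.
--  * Right-hand side.  A product A · 1/(1 - q^(i+1) t^j) is the unique series H
--    with H = A + q^(i+1) t^j H (Recurrence, recurrence-unique, ⊛-geom).  Peeling
--    off one geometric factor at a time identifies the coefficient of q^a t^c as
--    rhsCoeff a c = X a c + Y a c, for arrays X, Y given by explicit recursions.
--  * Left-hand side.  gauss k m i counts partitions of i in a k × m box; it obeys
--    both q-Pascal rules and the box symmetry, hence so do (anti-symmetrically)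
--    the first differences Δ k m.  Evaluating Δ 2 and Δ 3 near the middle, and
--    then Δ 4 by induction on a, gives f a c = rhsCoeff a c (f-closed).
-- Parts (b) and (c) are then statements about rhsCoeff: it is a natural number,
-- its zeros are located by the recursion rhsCoeff (a+1) (c+2) =
-- rhsCoeff a c + parts23 (a - c - 1), and rhsCoeff a 0 = parts23 a counts the
-- partitions of a into parts 2 and 3, which is ⌊(a + 3δ)/6⌋.

module Submission where

open import Defs
open import Data.Nat using (ℕ; _≤_; _∸_; _+_; _*_; _/_)
open import Data.Integer using (ℤ; +_) renaming (_≤_ to _≤ℤ_)
open import Data.Product using (_×_; ∃)
open import Data.Sum using (_⊎_)
open import Function.Bundles using (_⇔_)
open import Relation.Binary.PropositionalEquality using (_≡_)

open import Data.Nat using (zero; suc; _<_; _≡ᵇ_; _≤ᵇ_; z≤n; s≤s)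
open import Data.Nat.DivMod using (_%_; m/n≡1+[m∸n]/n; [m+kn]%n≡m%n)
import Data.Nat.Properties as ℕₚ
open import Data.Integer using (-[1+_]; _⊖_; +≤+)
  renaming (_+_ to _+ℤ_; _-_ to _-ℤ_; _*_ to _*ℤ_; -_ to -ℤ_)
import Data.Integer.Properties as ℤₚ
open import Data.Integer.Tactic.RingSolver using (solve-∀)
open import Algebra.Properties.CommutativeSemigroup ℕₚ.+-commutativeSemigroup
  using () renaming (interchange to +-interchange)
open import Algebra.Properties.CommutativeSemigroup ℤₚ.+-commutativeSemigroup
  using () renaming (interchange to +ℤ-interchange)
open import Data.Bool using (Bool; true; false; if_then_else_; _∧_; T)
open import Data.Bool.Properties using (∧-zeroʳ)
open import Data.Unit using (tt)
open import Data.Empty using (⊥-elim)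
open import Data.Product using (Σ; _,_)
open import Data.Sum using (inj₁; inj₂)
open import Data.List using (List; []; _∷_; _++_; _∷ʳ_; map; concatMap; upTo; applyUpTo; filterᵇ; length)
open import Data.List.Properties using (filter-++; length-++; map-++; map-cong; upTo-∷ʳ)
open import Data.Nat.ListAction using (sum)
open import Data.Nat.ListAction.Properties using (sum-++)
open import Function using (_∘_)
open import Function.Bundles using (mk⇔)
open import Relation.Nullary using (yes; no)
open import Relation.Nullary.Decidable using (T?)
open import Relation.Binary.PropositionalEquality using (_≢_; refl; sym; trans; cong; cong₂; subst; module ≡-Reasoning)
open ≡-Reasoning

≤ᵇ⇒≤ : ∀ m n → (m ≤ᵇ n) ≡ true → m ≤ n
≤ᵇ⇒≤ m n e = ℕₚ.≤ᵇ⇒≤ m n (subst T (sym e) tt)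

≤⇒≤ᵇ : ∀ {m n} → m ≤ n → (m ≤ᵇ n) ≡ true
≤⇒≤ᵇ {m} {n} m≤n with m ≤ᵇ n in e
... | true  = refl
... | false = ⊥-elim (subst T e (ℕₚ.≤⇒≤ᵇ m≤n))

≰ᵇ⇒> : ∀ m n → (m ≤ᵇ n) ≡ false → n < m
≰ᵇ⇒> m n e = ℕₚ.≰⇒> (λ m≤n → subst T e (ℕₚ.≤⇒≤ᵇ m≤n))

>⇒≰ᵇ : ∀ {m n} → n < m → (m ≤ᵇ n) ≡ false
>⇒≰ᵇ {m} {n} n<m with m ≤ᵇ n in e
... | false = refl
... | true  = ⊥-elim (ℕₚ.<⇒≱ n<m (≤ᵇ⇒≤ m n e))

-- The library's _≤ᵇ_ is defined through _<ᵇ_, so this step is not definitional.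
suc-≤ᵇ : ∀ m n → (suc m ≤ᵇ suc n) ≡ (m ≤ᵇ n)
suc-≤ᵇ zero    n = refl
suc-≤ᵇ (suc m) n = refl

≢⇒≢ᵇ : ∀ {m n} → m ≢ n → (m ≡ᵇ n) ≡ false
≢⇒≢ᵇ {m} {n} m≢n with m ≡ᵇ n in e
... | false = refl
... | true  = ⊥-elim (m≢n (ℕₚ.≡ᵇ⇒≡ m n (subst T (sym e) tt)))

+-≡ᵇ-cancelˡ : ∀ s m n → (s + m ≡ᵇ s + n) ≡ (m ≡ᵇ n)
+-≡ᵇ-cancelˡ zero    m n = refl
+-≡ᵇ-cancelˡ (suc s) m n = +-≡ᵇ-cancelˡ s m n

∑ : ℕ → (ℕ → ℤ) → ℤ
∑ zero    h = + 0
∑ (suc n) h = h 0 +ℤ ∑ n (h ∘ suc)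

sumℤ-++ : ∀ (xs ys : List ℤ) → sumℤ (xs ++ ys) ≡ sumℤ xs +ℤ sumℤ ys
sumℤ-++ []       ys = sym (ℤₚ.+-identityˡ _)
sumℤ-++ (x ∷ xs) ys = trans (cong (x +ℤ_) (sumℤ-++ xs ys)) (sym (ℤₚ.+-assoc x _ _))

sumℤ-concatMap : ∀ (F : ℕ → List ℤ) xs → sumℤ (concatMap F xs) ≡ sumℤ (map (sumℤ ∘ F) xs)
sumℤ-concatMap F []       = refl
sumℤ-concatMap F (x ∷ xs) = trans (sumℤ-++ (F x) (concatMap F xs)) (cong (sumℤ (F x) +ℤ_) (sumℤ-concatMap F xs))

sumℤ-applyUpTo : ∀ n (h : ℕ → ℤ) (g : ℕ → ℕ) → sumℤ (map h (applyUpTo g n)) ≡ ∑ n (h ∘ g)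
sumℤ-applyUpTo zero    h g = refl
sumℤ-applyUpTo (suc n) h g = cong (h (g 0) +ℤ_) (sumℤ-applyUpTo n h (g ∘ suc))

∑-cong< : ∀ n {h h′ : ℕ → ℤ} → (∀ x → x < n → h x ≡ h′ x) → ∑ n h ≡ ∑ n h′
∑-cong< zero    eq = refl
∑-cong< (suc n) eq = cong₂ _+ℤ_ (eq 0 (s≤s z≤n)) (∑-cong< n (λ x x<n → eq (suc x) (s≤s x<n)))

∑-cong : ∀ n {h h′ : ℕ → ℤ} → (∀ x → h x ≡ h′ x) → ∑ n h ≡ ∑ n h′
∑-cong n eq = ∑-cong< n (λ x _ → eq x)

∑-zero : ∀ n {h : ℕ → ℤ} → (∀ x → h x ≡ + 0) → ∑ n h ≡ + 0
∑-zero zero    eq = refl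
∑-zero (suc n) eq = cong₂ _+ℤ_ (eq 0) (∑-zero n (eq ∘ suc))

∑-+ : ∀ n (h h′ : ℕ → ℤ) → ∑ n (λ x → h x +ℤ h′ x) ≡ ∑ n h +ℤ ∑ n h′
∑-+ zero    h h′ = refl
∑-+ (suc n) h h′ = trans (cong (h 0 +ℤ h′ 0 +ℤ_) (∑-+ n (h ∘ suc) (h′ ∘ suc))) (+ℤ-interchange (h 0) (h′ 0) _ _)

∑-split : ∀ m n (h : ℕ → ℤ) → ∑ (m + n) h ≡ ∑ m h +ℤ ∑ n (λ x → h (m + x))
∑-split zero    n h = sym (ℤₚ.+-identityˡ _)
∑-split (suc m) n h = trans (cong (h 0 +ℤ_) (∑-split m n (h ∘ suc))) (sym (ℤₚ.+-assoc (h 0) _ _))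

∑-if : ∀ n b (h : ℕ → ℤ) → ∑ n (λ x → if b then h x else + 0) ≡ (if b then ∑ n h else + 0)
∑-if n true  h = refl
∑-if n false h = ∑-zero n (λ _ → refl)

-- Only the last index x = a satisfies a ∸ x = 0.
∑-last : ∀ a (h : ℕ → ℤ) → ∑ (suc a) (λ x → if (a ∸ x) ≡ᵇ 0 then h x else + 0) ≡ h a
∑-last zero    h = ℤₚ.+-identityʳ (h 0)
∑-last (suc a) h = trans (ℤₚ.+-identityˡ _) (∑-last a (h ∘ suc))

∑-restrict : ∀ k a (h : ℕ → ℤ) → ∑ (suc (k + a)) (λ x → if x ≤ᵇ a then h x else + 0) ≡ ∑ (suc a) h
∑-restrict k a h = trans (cong (λ n → ∑ (suc n) (λ x → if x ≤ᵇ a then h x else + 0)) (ℕₚ.+-comm k a)) (go a h)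
  where
  go : ∀ a (h : ℕ → ℤ) → ∑ (suc (a + k)) (λ x → if x ≤ᵇ a then h x else + 0) ≡ ∑ (suc a) h
  go zero    h = cong (h 0 +ℤ_) (∑-zero k (λ _ → refl))
  go (suc a) h = cong (h 0 +ℤ_) (trans
    (∑-cong (suc (a + k)) (λ x → cong (λ b → if b then h (suc x) else + 0) (suc-≤ᵇ x a)))
    (go a (h ∘ suc)))

_⊕_ : Series → Series → Series
(F ⊕ G) a c = F a c +ℤ G a c

shifted : ℕ → ℕ → Series → Series
shifted i j H a c = if (suc i ≤ᵇ a) ∧ (j ≤ᵇ c) then H (a ∸ suc i) (c ∸ j) else + 0

+shifted-intro : ∀ i j (G B K : Series) →
  (∀ a₀ c₀ → G (suc i + a₀) (j + c₀) ≡ B (suc i + a₀) (j + c₀) +ℤ K a₀ c₀) →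
  (∀ a c → ((suc i ≤ᵇ a) ∧ (j ≤ᵇ c)) ≡ false → G a c ≡ B a c) →
  ∀ a c → G a c ≡ (B ⊕ shifted i j K) a c
+shifted-intro i j G B K inside outside a c with suc i ≤ᵇ a in ea | j ≤ᵇ c in ec
... | false | _     = trans (outside a c (cong (_∧ (j ≤ᵇ c)) ea)) (sym (ℤₚ.+-identityʳ _))
... | true  | false = trans (outside a c (cong₂ _∧_ ea ec)) (sym (ℤₚ.+-identityʳ _))
... | true  | true  = begin
  G a c                                           ≡⟨ sym (cong₂ G a≡ c≡) ⟩
  G (suc i + (a ∸ suc i)) (j + (c ∸ j))           ≡⟨ inside (a ∸ suc i) (c ∸ j) ⟩
  B (suc i + (a ∸ suc i)) (j + (c ∸ j)) +ℤ K _ _  ≡⟨ cong (_+ℤ K (a ∸ suc i) (c ∸ j)) (cong₂ B a≡ c≡) ⟩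
  B a c +ℤ K (a ∸ suc i) (c ∸ j)                  ∎
  where
  a≡ : suc i + (a ∸ suc i) ≡ a
  a≡ = ℕₚ.m+[n∸m]≡n (≤ᵇ⇒≤ (suc i) a ea)
  c≡ : j + (c ∸ j) ≡ c
  c≡ = ℕₚ.m+[n∸m]≡n (≤ᵇ⇒≤ j c ec)

-- H satisfies the coefficientwise form of H = B + q^(i+1) t^j H,
-- i.e. of H = B / (1 - q^(i+1) t^j).
Recurrence : ℕ → ℕ → Series → Series → Set
Recurrence i j B H = ∀ a c → H a c ≡ (B ⊕ shifted i j H) a c

-- The recurrence determines H, by induction on the q-degree (the shift lowers it).
recurrence-unique : ∀ i j B H K → Recurrence i j B H → Recurrence i j B K → ∀ a c → H a c ≡ K a c
recurrence-unique i j B H K recH recK a c = go (suc a) a c (ℕₚ.n<1+n a)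
  where
  go : ∀ n a c → a < n → H a c ≡ K a c
  go (suc n) a c (s≤s a≤n) = trans (recH a c) (trans (cong (B a c +ℤ_) shifts) (sym (recK a c)))
    where
    shifts : shifted i j H a c ≡ shifted i j K a c
    shifts with suc i ≤ᵇ a in ea | j ≤ᵇ c
    ... | false | _     = refl
    ... | true  | false = refl
    ... | true  | true  = go n (a ∸ suc i) (c ∸ j) (ℕₚ.<-≤-trans (ℕₚ.∸-monoʳ-< (s≤s z≤n) (≤ᵇ⇒≤ (suc i) a ea)) a≤n)

mono-shift : ∀ s t u v a c → mono (s + u) (t + v) (s + a) (t + c) ≡ mono u v a c
mono-shift s t u v a c rewrite +-≡ᵇ-cancelˡ s a u | +-≡ᵇ-cancelˡ t c v = refl

mono-belowᵃ : ∀ {i j a} c → a < i → mono i j a c ≡ + 0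
mono-belowᵃ c a<i rewrite ≢⇒≢ᵇ (ℕₚ.<⇒≢ a<i) = refl

mono-belowᶜ : ∀ {i j} a {c} → c < j → mono i j a c ≡ + 0
mono-belowᶜ {i} a c<j rewrite ≢⇒≢ᵇ (ℕₚ.<⇒≢ c<j) | ∧-zeroʳ (a ≡ᵇ i) = refl

geom-∑ : ∀ i j a c → geom i j a c ≡ ∑ (suc a) (λ k → mono (k * suc i) (k * j) a c)
geom-∑ i j a c = sumℤ-applyUpTo (suc a) (λ k → mono (k * suc i) (k * j) a c) (λ k → k)

geom-recurrence : ∀ i j → Recurrence i j (mono 0 0) (geom i j)
geom-recurrence i j = +shifted-intro i j (geom i j) (mono 0 0) (geom i j) inside outside
  where
  inside : ∀ a₀ c₀ → geom i j (suc i + a₀) (j + c₀) ≡ mono 0 0 (suc i + a₀) (j + c₀) +ℤ geom i j a₀ c₀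
  inside a₀ c₀ = trans (geom-∑ i j (suc i + a₀) (j + c₀)) (cong (mono 0 0 (suc i + a₀) (j + c₀) +ℤ_) higher)
    where
    term : ℕ → ℤ
    term k = mono (k * suc i) (k * j) a₀ c₀
    -- terms with k > a₀ have q-degree k(i+1) > a₀
    beyond : ∀ x → term (suc a₀ + x) ≡ + 0
    beyond x = mono-belowᵃ c₀ (ℕₚ.≤-trans (ℕₚ.m≤m+n (suc a₀) x) (ℕₚ.m≤m*n (suc a₀ + x) (suc i)))
    higher : ∑ (suc i + a₀) (λ k → mono (suc k * suc i) (suc k * j) (suc i + a₀) (j + c₀)) ≡ geom i j a₀ c₀
    higher = begin
      ∑ (suc i + a₀) (λ k → mono (suc i + k * suc i) (j + k * j) (suc i + a₀) (j + c₀))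
        ≡⟨ ∑-cong (suc i + a₀) (λ k → mono-shift (suc i) j (k * suc i) (k * j) a₀ c₀) ⟩
      ∑ (suc i + a₀) term                            ≡⟨ cong (λ n → ∑ (suc n) term) (ℕₚ.+-comm i a₀) ⟩
      ∑ (suc a₀ + i) term                            ≡⟨ ∑-split (suc a₀) i term ⟩
      ∑ (suc a₀) term +ℤ ∑ i (λ x → term (suc a₀ + x)) ≡⟨ cong (∑ (suc a₀) term +ℤ_) (∑-zero i beyond) ⟩
      ∑ (suc a₀) term +ℤ + 0                         ≡⟨ ℤₚ.+-identityʳ _ ⟩
      ∑ (suc a₀) term                                ≡⟨ sym (geom-∑ i j a₀ c₀) ⟩
      geom i j a₀ c₀                                 ∎
  outside : ∀ a c → ((suc i ≤ᵇ a) ∧ (j ≤ᵇ c)) ≡ false → geom i j a c ≡ mono 0 0 a c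
  outside a c e = trans (geom-∑ i j a c) (trans (cong (mono 0 0 a c +ℤ_) (∑-zero a vanish)) (ℤₚ.+-identityʳ _))
    where
    vanish : ∀ k → mono (suc k * suc i) (suc k * j) a c ≡ + 0
    vanish k with suc i ≤ᵇ a in ea
    ... | false = mono-belowᵃ c (ℕₚ.<-≤-trans (≰ᵇ⇒> (suc i) a ea) (ℕₚ.m≤m+n (suc i) _))
    ... | true  = mono-belowᶜ a (ℕₚ.<-≤-trans (≰ᵇ⇒> j c e) (ℕₚ.m≤m+n j _))

⊛-coeff : ∀ (A B : Series) a c → (A ⊛ B) a c ≡ ∑ (suc a) (λ x → ∑ (suc c) (λ y → A x y *ℤ B (a ∸ x) (c ∸ y)))
⊛-coeff A B a c = begin
  sumℤ (concatMap row (upTo (suc a)))   ≡⟨ sumℤ-concatMap row (upTo (suc a)) ⟩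
  sumℤ (map (sumℤ ∘ row) (upTo (suc a))) ≡⟨ sumℤ-applyUpTo (suc a) (sumℤ ∘ row) (λ x → x) ⟩
  ∑ (suc a) (sumℤ ∘ row)                ≡⟨ ∑-cong (suc a) (λ x → sumℤ-applyUpTo (suc c) (term x) (λ y → y)) ⟩
  ∑ (suc a) (λ x → ∑ (suc c) (term x))  ∎
  where
  term : ℕ → ℕ → ℤ
  term x y = A x y *ℤ B (a ∸ x) (c ∸ y)
  row : ℕ → List ℤ
  row x = map (term x) (upTo (suc c))

⊛-congʳ : ∀ A {B B′ : Series} → (∀ a c → B a c ≡ B′ a c) → ∀ a c → (A ⊛ B) a c ≡ (A ⊛ B′) a c
⊛-congʳ A {B} {B′} eq a c = begin
  (A ⊛ B) a c   ≡⟨ ⊛-coeff A B a c ⟩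
  ∑ (suc a) (λ x → ∑ (suc c) (λ y → A x y *ℤ B (a ∸ x) (c ∸ y)))
    ≡⟨ ∑-cong (suc a) (λ x → ∑-cong (suc c) (λ y → cong (A x y *ℤ_) (eq (a ∸ x) (c ∸ y)))) ⟩
  ∑ (suc a) (λ x → ∑ (suc c) (λ y → A x y *ℤ B′ (a ∸ x) (c ∸ y)))
    ≡⟨ sym (⊛-coeff A B′ a c) ⟩
  (A ⊛ B′) a c  ∎

⊛-distribˡ-⊕ : ∀ A B C a c → (A ⊛ (B ⊕ C)) a c ≡ (A ⊛ B) a c +ℤ (A ⊛ C) a c
⊛-distribˡ-⊕ A B C a c = begin
  (A ⊛ (B ⊕ C)) a c                                      ≡⟨ ⊛-coeff A (B ⊕ C) a c ⟩
  ∑ (suc a) (λ x → ∑ (suc c) (term (B ⊕ C) x))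
    ≡⟨ ∑-cong (suc a) (λ x → ∑-cong (suc c) (λ y →
         ℤₚ.*-distribˡ-+ (A x y) (B (a ∸ x) (c ∸ y)) (C (a ∸ x) (c ∸ y)))) ⟩
  ∑ (suc a) (λ x → ∑ (suc c) (λ y → term B x y +ℤ term C x y))
    ≡⟨ ∑-cong (suc a) (λ x → ∑-+ (suc c) (term B x) (term C x)) ⟩
  ∑ (suc a) (λ x → ∑ (suc c) (term B x) +ℤ ∑ (suc c) (term C x))
    ≡⟨ ∑-+ (suc a) (λ x → ∑ (suc c) (term B x)) (λ x → ∑ (suc c) (term C x)) ⟩
  ∑ (suc a) (λ x → ∑ (suc c) (term B x)) +ℤ ∑ (suc a) (λ x → ∑ (suc c) (term C x))
    ≡⟨ sym (cong₂ _+ℤ_ (⊛-coeff A B a c) (⊛-coeff A C a c)) ⟩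
  (A ⊛ B) a c +ℤ (A ⊛ C) a c                             ∎
  where
  term : Series → ℕ → ℕ → ℤ
  term F x y = A x y *ℤ F (a ∸ x) (c ∸ y)

⊛-identityʳ : ∀ A a c → (A ⊛ mono 0 0) a c ≡ A a c
⊛-identityʳ A a c = begin
  (A ⊛ mono 0 0) a c                ≡⟨ ⊛-coeff A (mono 0 0) a c ⟩
  ∑ (suc a) (λ x → ∑ (suc c) (λ y → A x y *ℤ mono 0 0 (a ∸ x) (c ∸ y)))
    ≡⟨ ∑-cong (suc a) (λ x → trans (∑-cong (suc c) (λ y → times-unit (A x y) (a ∸ x) (c ∸ y)))
                                   (∑-if (suc c) ((a ∸ x) ≡ᵇ 0) (λ y → if (c ∸ y) ≡ᵇ 0 then A x y else + 0))) ⟩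
  ∑ (suc a) (λ x → if (a ∸ x) ≡ᵇ 0 then ∑ (suc c) (λ y → if (c ∸ y) ≡ᵇ 0 then A x y else + 0) else + 0)
    ≡⟨ ∑-last a (λ x → ∑ (suc c) (λ y → if (c ∸ y) ≡ᵇ 0 then A x y else + 0)) ⟩
  ∑ (suc c) (λ y → if (c ∸ y) ≡ᵇ 0 then A a y else + 0)
    ≡⟨ ∑-last c (A a) ⟩
  A a c                             ∎
  where
  times-unit : ∀ z p q → z *ℤ mono 0 0 p q ≡ (if p ≡ᵇ 0 then (if q ≡ᵇ 0 then z else + 0) else + 0)
  times-unit z p q with p ≡ᵇ 0 | q ≡ᵇ 0
  ... | true  | true  = ℤₚ.*-identityʳ z
  ... | true  | false = ℤₚ.*-zeroʳ z
  ... | false | _     = ℤₚ.*-zeroʳ z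

≤ᵇ-∸-flip : ∀ s a x → x ≤ s + a → (s ≤ᵇ (s + a) ∸ x) ≡ (x ≤ᵇ a)
≤ᵇ-∸-flip s a x x≤s+a with x ℕₚ.≤? a
... | yes x≤a = trans (cong (s ≤ᵇ_) (ℕₚ.+-∸-assoc s x≤a)) (trans (≤⇒≤ᵇ (ℕₚ.m≤m+n s (a ∸ x))) (sym (≤⇒≤ᵇ x≤a)))
... | no  x≰a = trans (>⇒≰ᵇ short) (sym (>⇒≰ᵇ (ℕₚ.≰⇒> x≰a)))
  where
  short : (s + a) ∸ x < s
  short = ℕₚ.+-cancelʳ-< x ((s + a) ∸ x) s
            (subst (_< s + x) (sym (ℕₚ.m∸n+n≡m x≤s+a)) (ℕₚ.+-monoʳ-< s (ℕₚ.≰⇒> x≰a)))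

+∸∸-cancel : ∀ s a x → x ≤ a → (s + a) ∸ x ∸ s ≡ a ∸ x
+∸∸-cancel s a x x≤a = trans (cong (_∸ s) (ℕₚ.+-∸-assoc s x≤a)) (ℕₚ.m+n∸m≡n s (a ∸ x))

≰ᵇ-∸ : ∀ s a x → (s ≤ᵇ a) ≡ false → (s ≤ᵇ a ∸ x) ≡ false
≰ᵇ-∸ s a x e = >⇒≰ᵇ (ℕₚ.≤-<-trans (ℕₚ.m∸n≤m a x) (≰ᵇ⇒> s a e))

⊛-shifted : ∀ i j A H a c → (A ⊛ shifted i j H) a c ≡ shifted i j (A ⊛ H) a c
⊛-shifted i j A H a c =
  trans (+shifted-intro i j (A ⊛ shifted i j H) (λ _ _ → + 0) (A ⊛ H) inside outside a c) (ℤₚ.+-identityˡ _)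
  where
  inside : ∀ a₀ c₀ → (A ⊛ shifted i j H) (suc i + a₀) (j + c₀) ≡ + 0 +ℤ (A ⊛ H) a₀ c₀
  inside a₀ c₀ = begin
    (A ⊛ shifted i j H) (suc i + a₀) (j + c₀)  ≡⟨ ⊛-coeff A (shifted i j H) (suc i + a₀) (j + c₀) ⟩
    ∑ (suc (suc i + a₀)) (λ x → ∑ (suc (j + c₀)) (λ y → A x y *ℤ shifted i j H (suc i + a₀ ∸ x) (j + c₀ ∸ y)))
      ≡⟨ ∑-cong< (suc (suc i + a₀)) (λ x x< → trans
           (∑-cong< (suc (j + c₀)) (λ y y< → term-shifted x y (ℕₚ.≤-pred x<) (ℕₚ.≤-pred y<)))
           (∑-if (suc (j + c₀)) (x ≤ᵇ a₀) (restricted x))) ⟩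
    ∑ (suc (suc i + a₀)) (λ x → if x ≤ᵇ a₀ then ∑ (suc (j + c₀)) (restricted x) else + 0)
      ≡⟨ ∑-restrict (suc i) a₀ (λ x → ∑ (suc (j + c₀)) (restricted x)) ⟩
    ∑ (suc a₀) (λ x → ∑ (suc (j + c₀)) (restricted x))
      ≡⟨ ∑-cong (suc a₀) (λ x → ∑-restrict j c₀ (λ y → A x y *ℤ H (a₀ ∸ x) (c₀ ∸ y))) ⟩
    ∑ (suc a₀) (λ x → ∑ (suc c₀) (λ y → A x y *ℤ H (a₀ ∸ x) (c₀ ∸ y)))
      ≡⟨ sym (⊛-coeff A H a₀ c₀) ⟩
    (A ⊛ H) a₀ c₀                              ≡⟨ sym (ℤₚ.+-identityˡ _) ⟩
    + 0 +ℤ (A ⊛ H) a₀ c₀                       ∎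
    where
    restricted : ℕ → ℕ → ℤ
    restricted x y = if y ≤ᵇ c₀ then A x y *ℤ H (a₀ ∸ x) (c₀ ∸ y) else + 0
    term-shifted : ∀ x y → x ≤ suc i + a₀ → y ≤ j + c₀ →
      A x y *ℤ shifted i j H (suc i + a₀ ∸ x) (j + c₀ ∸ y) ≡ (if x ≤ᵇ a₀ then restricted x y else + 0)
    term-shifted x y hx hy rewrite ≤ᵇ-∸-flip (suc i) a₀ x hx | ≤ᵇ-∸-flip j c₀ y hy
      with x ≤ᵇ a₀ in ex | y ≤ᵇ c₀ in ey
    ... | true  | true  rewrite +∸∸-cancel (suc i) a₀ x (≤ᵇ⇒≤ x a₀ ex) | +∸∸-cancel j c₀ y (≤ᵇ⇒≤ y c₀ ey) = refl
    ... | true  | false = ℤₚ.*-zeroʳ (A x y)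
    ... | false | _     = ℤₚ.*-zeroʳ (A x y)
  outside : ∀ a c → ((suc i ≤ᵇ a) ∧ (j ≤ᵇ c)) ≡ false → (A ⊛ shifted i j H) a c ≡ + 0
  outside a c e = trans (⊛-coeff A (shifted i j H) a c)
    (∑-zero (suc a) (λ x → ∑-zero (suc c) (λ y → trans (cong (A x y *ℤ_) (vanish x y)) (ℤₚ.*-zeroʳ (A x y)))))
    where
    vanish : ∀ x y → shifted i j H (a ∸ x) (c ∸ y) ≡ + 0
    vanish x y with suc i ≤ᵇ a in ea
    ... | false rewrite ≰ᵇ-∸ (suc i) a x ea = refl
    ... | true  rewrite ≰ᵇ-∸ j c y e | ∧-zeroʳ (suc i ≤ᵇ a ∸ x) = refl

⊛-recurrence : ∀ i j A H → Recurrence i j (mono 0 0) H → Recurrence i j A (A ⊛ H)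
⊛-recurrence i j A H recH a c = begin
  (A ⊛ H) a c                                        ≡⟨ ⊛-congʳ A recH a c ⟩
  (A ⊛ (mono 0 0 ⊕ shifted i j H)) a c               ≡⟨ ⊛-distribˡ-⊕ A (mono 0 0) (shifted i j H) a c ⟩
  (A ⊛ mono 0 0) a c +ℤ (A ⊛ shifted i j H) a c      ≡⟨ cong₂ _+ℤ_ (⊛-identityʳ A a c) (⊛-shifted i j A H a c) ⟩
  A a c +ℤ shifted i j (A ⊛ H) a c                   ∎

⊛-geom : ∀ i j A {B H} → (∀ a c → A a c ≡ B a c) → Recurrence i j B H → ∀ a c → (A ⊛ geom i j) a c ≡ H a c
⊛-geom i j A {B} {H} A≡B recH = recurrence-unique i j B (A ⊛ geom i j) H recAG recH
  where
  recAG : Recurrence i j B (A ⊛ geom i j)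
  recAG a c = trans (⊛-recurrence i j A (geom i j) (geom-recurrence i j) a c)
                    (cong (_+ℤ shifted i j (A ⊛ geom i j) a c) (A≡B a c))

-- isEven a = [a even], the coefficient of q^a in 1/(1 - q²).
isEven : ℕ → ℕ
isEven zero          = 1
isEven (suc zero)    = 0
isEven (suc (suc n)) = isEven n

-- parts23 a = number of partitions of a into parts 2 and 3, the coefficient of
-- q^a in 1/((1 - q²)(1 - q³)); the recurrence splits off one part 3 or none.
parts23 : ℕ → ℕ
parts23 zero                = 1
parts23 (suc zero)          = 0
parts23 (suc (suc zero))    = 1
parts23 (suc (suc (suc n))) = isEven (suc (suc (suc n))) + parts23 n

lift : (ℕ → ℕ → ℕ) → Series
lift F a c = + F a c

atT⁰ : (ℕ → ℕ) → ℕ → ℕ → ℕ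
atT⁰ g a zero    = g a
atT⁰ g a (suc c) = 0

-- X = 1/((1 - q²)(1 - q³)(1 - q t²)): X a (2k) = parts23 (a - k) for k ≤ a, zero otherwise.
X : ℕ → ℕ → ℕ
X a       zero          = parts23 a
X a       (suc zero)    = 0
X zero    (suc (suc c)) = 0
X (suc a) (suc (suc c)) = X a c

shift₂₂ : (ℕ → ℕ → ℕ) → ℕ → ℕ → ℕ
shift₂₂ F (suc (suc a)) (suc (suc c)) = F a c
shift₂₂ F _             _             = 0

-- Division by 1 - q t: summation along the diagonal.
diagonalSum : (ℕ → ℕ → ℕ) → ℕ → ℕ → ℕ
diagonalSum F zero    c       = F zero c
diagonalSum F (suc a) zero    = F (suc a) zero
diagonalSum F (suc a) (suc c) = F (suc a) (suc c) + diagonalSum F a c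

-- Y = q² t² X/(1 - q t), the second summand of (a).
Y : ℕ → ℕ → ℕ
Y = diagonalSum (shift₂₂ X)

even-rec : Recurrence 1 0 (mono 0 0) (lift (atT⁰ isEven))
even-rec = +shifted-intro 1 0 (lift (atT⁰ isEven)) (mono 0 0) (lift (atT⁰ isEven))
  (λ { a₀ zero → refl ; a₀ (suc c) → refl })
  (λ { zero zero e → refl ; zero (suc c) e → refl ; (suc zero) zero e → refl ; (suc zero) (suc c) e → refl
     ; (suc (suc a)) c () })

parts23-rec : Recurrence 2 0 (lift (atT⁰ isEven)) (lift (atT⁰ parts23))
parts23-rec = +shifted-intro 2 0 (lift (atT⁰ parts23)) (lift (atT⁰ isEven)) (lift (atT⁰ parts23))
  (λ { a₀ zero → refl ; a₀ (suc c) → refl })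
  (λ { zero zero e → refl ; zero (suc c) e → refl ; (suc zero) zero e → refl ; (suc zero) (suc c) e → refl
     ; (suc (suc zero)) zero e → refl ; (suc (suc zero)) (suc c) e → refl ; (suc (suc (suc a))) c () })

X-rec : Recurrence 0 2 (lift (atT⁰ parts23)) (lift X)
X-rec = +shifted-intro 0 2 (lift X) (lift (atT⁰ parts23)) (lift X)
  (λ a₀ c₀ → refl)
  (λ { zero zero e → refl ; zero (suc zero) e → refl ; zero (suc (suc c)) e → refl
     ; (suc a) zero e → refl ; (suc a) (suc zero) e → refl ; (suc a) (suc (suc c)) () })

shifted-even-rec : Recurrence 1 0 (mono 2 2) (lift (shift₂₂ (atT⁰ isEven)))
shifted-even-rec = +shifted-intro 1 0 (lift (shift₂₂ (atT⁰ isEven))) (mono 2 2) (lift (shift₂₂ (atT⁰ isEven)))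
  (λ { zero zero → refl ; zero (suc zero) → refl ; zero (suc (suc zero)) → refl ; zero (suc (suc (suc c))) → refl
     ; (suc zero) zero → refl ; (suc zero) (suc zero) → refl ; (suc zero) (suc (suc zero)) → refl ; (suc zero) (suc (suc (suc c))) → refl
     ; (suc (suc a)) zero → refl ; (suc (suc a)) (suc zero) → refl ; (suc (suc a)) (suc (suc zero)) → refl ; (suc (suc a)) (suc (suc (suc c))) → refl })
  (λ { zero zero e → refl ; zero (suc zero) e → refl ; zero (suc (suc zero)) e → refl ; zero (suc (suc (suc c))) e → refl
     ; (suc zero) zero e → refl ; (suc zero) (suc zero) e → refl ; (suc zero) (suc (suc zero)) e → refl ; (suc zero) (suc (suc (suc c))) e → refl
     ; (suc (suc a)) c () })

shifted-parts23-rec : Recurrence 2 0 (lift (shift₂₂ (atT⁰ isEven))) (lift (shift₂₂ (atT⁰ parts23)))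
shifted-parts23-rec = +shifted-intro 2 0 (lift (shift₂₂ (atT⁰ parts23))) (lift (shift₂₂ (atT⁰ isEven))) (lift (shift₂₂ (atT⁰ parts23)))
  (λ { zero zero → refl ; zero (suc zero) → refl ; zero (suc (suc zero)) → refl ; zero (suc (suc (suc c))) → refl
     ; (suc zero) zero → refl ; (suc zero) (suc zero) → refl ; (suc zero) (suc (suc zero)) → refl ; (suc zero) (suc (suc (suc c))) → refl
     ; (suc (suc a)) zero → refl ; (suc (suc a)) (suc zero) → refl ; (suc (suc a)) (suc (suc zero)) → refl ; (suc (suc a)) (suc (suc (suc c))) → refl })
  (λ { zero (suc (suc zero)) e → refl ; (suc zero) (suc (suc zero)) e → refl ; (suc (suc zero)) (suc (suc zero)) e → refl
     ; zero zero e → refl ; zero (suc zero) e → refl ; zero (suc (suc (suc c))) e → refl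
     ; (suc zero) zero e → refl ; (suc zero) (suc zero) e → refl ; (suc zero) (suc (suc (suc c))) e → refl
     ; (suc (suc zero)) zero e → refl ; (suc (suc zero)) (suc zero) e → refl ; (suc (suc zero)) (suc (suc (suc c))) e → refl
     ; (suc (suc (suc a))) c () })

shifted-X-rec : Recurrence 0 2 (lift (shift₂₂ (atT⁰ parts23))) (lift (shift₂₂ X))
shifted-X-rec = +shifted-intro 0 2 (lift (shift₂₂ X)) (lift (shift₂₂ (atT⁰ parts23))) (lift (shift₂₂ X))
  (λ { zero zero → refl ; zero (suc zero) → refl ; zero (suc (suc c)) → refl
     ; (suc zero) zero → refl ; (suc zero) (suc zero) → refl ; (suc (suc a)) zero → sym (cong +_ (ℕₚ.+-identityʳ _))
     ; (suc (suc a)) (suc zero) → refl ; (suc zero) (suc (suc c)) → refl ; (suc (suc a)) (suc (suc c)) → refl })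
  (λ { zero zero e → refl ; zero (suc zero) e → refl ; zero (suc (suc zero)) e → refl ; zero (suc (suc (suc c))) e → refl
     ; (suc zero) zero e → refl ; (suc zero) (suc zero) e → refl
     ; (suc (suc a)) zero e → refl ; (suc (suc a)) (suc zero) e → refl
     ; (suc a) (suc (suc c)) () })

Y-rec : Recurrence 0 1 (lift (shift₂₂ X)) (lift Y)
Y-rec = +shifted-intro 0 1 (lift Y) (lift (shift₂₂ X)) (lift Y)
  (λ a₀ c₀ → refl)
  (λ { zero c e → refl ; (suc a) zero e → refl ; (suc a) (suc c) () })

rhsX : ∀ a c → (geom 1 0 ⊛ geom 2 0 ⊛ geom 0 2) a c ≡ lift X a c
rhsX = ⊛-geom 0 2 (geom 1 0 ⊛ geom 2 0) (⊛-geom 2 0 (geom 1 0) geom-even parts23-rec) X-rec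
  where
  geom-even : ∀ a c → geom 1 0 a c ≡ lift (atT⁰ isEven) a c
  geom-even = recurrence-unique 1 0 (mono 0 0) (geom 1 0) (lift (atT⁰ isEven)) (geom-recurrence 1 0) even-rec

rhsY : ∀ a c → (mono 2 2 ⊛ geom 1 0 ⊛ geom 2 0 ⊛ geom 0 2 ⊛ geom 0 1) a c ≡ lift Y a c
rhsY = ⊛-geom 0 1 (mono 2 2 ⊛ geom 1 0 ⊛ geom 2 0 ⊛ geom 0 2)
         (⊛-geom 0 2 (mono 2 2 ⊛ geom 1 0 ⊛ geom 2 0)
           (⊛-geom 2 0 (mono 2 2 ⊛ geom 1 0)
             (⊛-geom 1 0 (mono 2 2) (λ _ _ → refl) shifted-even-rec)
             shifted-parts23-rec)
           shifted-X-rec)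
         Y-rec

rhsCoeff : ℕ → ℕ → ℕ
rhsCoeff a c = X a c + Y a c

rhsA-coeff : ∀ a c → rhsA a c ≡ + rhsCoeff a c
rhsA-coeff a c = cong₂ _+ℤ_ (rhsX a c) (rhsY a c)

count : {A : Set} → (A → Bool) → List A → ℕ
count p xs = length (filterᵇ p xs)

count-++ : ∀ {A : Set} (p : A → Bool) xs ys → count p (xs ++ ys) ≡ count p xs + count p ys
count-++ p xs ys = trans (cong length (filter-++ (T? ∘ p) xs ys)) (length-++ (filterᵇ p xs))

count-concatMap : ∀ {A : Set} (p : A → Bool) (F : ℕ → List A) xs →
  count p (concatMap F xs) ≡ sum (map (count p ∘ F) xs)
count-concatMap p F []       = refl
count-concatMap p F (x ∷ xs) = trans (count-++ p (F x) (concatMap F xs)) (cong (_+_ (count p (F x))) (count-concatMap p F xs))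

count-map : ∀ {A B : Set} (p : B → Bool) (f : A → B) xs → count p (map f xs) ≡ count (p ∘ f) xs
count-map p f []       = refl
count-map p f (x ∷ xs) with p (f x)
... | true  = cong suc (count-map p f xs)
... | false = count-map p f xs

count-cong : ∀ {A : Set} {p p′ : A → Bool} → (∀ x → p x ≡ p′ x) → ∀ xs → count p xs ≡ count p′ xs
count-cong eq []       = refl
count-cong {p = p} {p′} eq (x ∷ xs) rewrite eq x with p′ x
... | true  = cong suc (count-cong eq xs)
... | false = count-cong eq xs

count-none : ∀ {A : Set} (xs : List A) → count (λ _ → false) xs ≡ 0
count-none []       = refl
count-none (x ∷ xs) = count-none xs

+-≡ᵇ : ∀ x s i → (x + s ≡ᵇ i) ≡ (if x ≤ᵇ i then (s ≡ᵇ i ∸ x) else false)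
+-≡ᵇ zero    s i       = refl
+-≡ᵇ (suc x) s zero    = refl
+-≡ᵇ (suc x) s (suc i) = trans (+-≡ᵇ x s i) (cong (λ b → if b then (s ≡ᵇ i ∸ x) else false) (sym (suc-≤ᵇ x i)))

-- gauss k m i = number of partitions of i into at most k parts of size at most m,
-- the coefficient of q^i in the Gaussian binomial [m+k choose k]_q; d a = gauss 4 a.
gauss : ℕ → ℕ → ℕ → ℕ
gauss k m i = count (λ p → sum p ≡ᵇ i) (boxPartitions k m)

-- Classifying by the largest part x ≤ m, the remaining parts form a partition
-- of i - x into at most k parts of size at most x.
gauss-largestPart : ∀ k m i → gauss (suc k) m i ≡ sum (map (λ x → if x ≤ᵇ i then gauss k x (i ∸ x) else 0) (upTo (suc m)))
gauss-largestPart k m i =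
  trans (count-concatMap _ (λ x → map (x ∷_) (boxPartitions k x)) (upTo (suc m)))
        (cong sum (map-cong by-largest (upTo (suc m))))
  where
  by-largest : ∀ x → count (λ p → sum p ≡ᵇ i) (map (x ∷_) (boxPartitions k x)) ≡ (if x ≤ᵇ i then gauss k x (i ∸ x) else 0)
  by-largest x = trans (count-map (λ p → sum p ≡ᵇ i) (x ∷_) (boxPartitions k x))
                       (trans (count-cong (λ p → +-≡ᵇ x (sum p) i) (boxPartitions k x)) guarded)
    where
    guarded : count (λ p → if x ≤ᵇ i then (sum p ≡ᵇ i ∸ x) else false) (boxPartitions k x)
              ≡ (if x ≤ᵇ i then gauss k x (i ∸ x) else 0)
    guarded with x ≤ᵇ i
    ... | true  = refl
    ... | false = count-none (boxPartitions k x)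

sum-upTo-suc : ∀ (g : ℕ → ℕ) n → sum (map g (upTo (suc n))) ≡ sum (map g (upTo n)) + g n
sum-upTo-suc g n = begin
  sum (map g (upTo (suc n)))            ≡⟨ cong (sum ∘ map g) (sym (upTo-∷ʳ n)) ⟩
  sum (map g (upTo n ∷ʳ n))             ≡⟨ cong sum (map-++ g (upTo n) (n ∷ [])) ⟩
  sum (map g (upTo n) ++ (g n ∷ []))    ≡⟨ sum-++ (map g (upTo n)) (g n ∷ []) ⟩
  sum (map g (upTo n)) + (g n + 0)      ≡⟨ cong (_+_ (sum (map g (upTo n)))) (ℕₚ.+-identityʳ (g n)) ⟩
  sum (map g (upTo n)) + g n            ∎

gaussℤ : ℕ → ℕ → ℤ → ℕ
gaussℤ k m (+ i)    = gauss k m i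
gaussℤ k m -[1+ _ ] = 0

unitAt0 : ℤ → ℕ
unitAt0 (+ zero)   = 1
unitAt0 (+ suc _)  = 0
unitAt0 -[1+ _ ]   = 0

unitAt0-neg : ∀ j → unitAt0 j ≡ unitAt0 (+ 0 -ℤ j)
unitAt0-neg (+ zero)  = refl
unitAt0-neg (+ suc n) = refl
unitAt0-neg -[1+ n ]  = refl

gaussℤ-noParts : ∀ m j → gaussℤ 0 m j ≡ unitAt0 j
gaussℤ-noParts m (+ zero)  = refl
gaussℤ-noParts m (+ suc i) = refl
gaussℤ-noParts m -[1+ n ]  = refl

gaussℤ-noSize : ∀ k j → gaussℤ k 0 j ≡ unitAt0 j
gaussℤ-noSize zero    j        = gaussℤ-noParts 0 j
gaussℤ-noSize (suc k) (+ i)    = trans (gauss-largestPart k 0 i) (trans (ℕₚ.+-identityʳ _) (gaussℤ-noSize k (+ i)))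
gaussℤ-noSize (suc k) -[1+ n ] = refl

negative-difference : ∀ i n → i < n → Σ ℕ (λ r → + i -ℤ + n ≡ -[1+ r ])
negative-difference zero    (suc n) _         = n , refl
negative-difference (suc i) (suc n) (s≤s i<n) with negative-difference i n i<n
... | r , eq = r , (begin
  + suc i -ℤ + suc n   ≡⟨ ℤₚ.m-n≡m⊖n (suc i) (suc n) ⟩
  suc i ⊖ suc n       ≡⟨ ℤₚ.[1+m]⊖[1+n]≡m⊖n i n ⟩
  i ⊖ n               ≡⟨ sym (ℤₚ.m-n≡m⊖n i n) ⟩
  + i -ℤ + n           ≡⟨ eq ⟩
  -[1+ r ]            ∎)

-- First q-Pascal rule: [k+m+2 choose k+1] = [k+m+1 choose k+1] + q^(m+1) [k+m+1 choose k],
-- separating the partitions whose largest part is exactly m+1.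
pascal₁ : ∀ k m j → gaussℤ (suc k) (suc m) j ≡ gaussℤ (suc k) m j + gaussℤ k (suc m) (j -ℤ + suc m)
pascal₁ k m -[1+ n ] = refl
pascal₁ k m (+ i) = begin
  gauss (suc k) (suc m) i                            ≡⟨ gauss-largestPart k (suc m) i ⟩
  sum (map byLargest (upTo (suc (suc m))))           ≡⟨ sum-upTo-suc byLargest (suc m) ⟩
  sum (map byLargest (upTo (suc m))) + byLargest (suc m) ≡⟨ cong₂ _+_ (sym (gauss-largestPart k m i)) largest ⟩
  gauss (suc k) m i + gaussℤ k (suc m) (+ i -ℤ + suc m) ∎
  where
  byLargest : ℕ → ℕ
  byLargest x = if x ≤ᵇ i then gauss k x (i ∸ x) else 0
  largest : byLargest (suc m) ≡ gaussℤ k (suc m) (+ i -ℤ + suc m)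
  largest with suc m ≤ᵇ i in e
  ... | true  = cong (gaussℤ k (suc m)) (sym (trans (ℤₚ.m-n≡m⊖n i (suc m)) (ℤₚ.⊖-≥ (≤ᵇ⇒≤ (suc m) i e))))
  ... | false with negative-difference i (suc m) (≰ᵇ⇒> (suc m) i e)
  ...   | r , eq = cong (gaussℤ k (suc m)) (sym eq)

-- Exponent bookkeeping for the Pascal rules (instances of ring identities, with
-- + suc n unfolding definitionally to + 1 +ℤ + n).

-suc-split : ∀ j m → j -ℤ + (2 + m) ≡ (j -ℤ + 1) -ℤ + suc m
-suc-split j m = identity j (+ m)
  where
  identity : ∀ (j x : ℤ) → j -ℤ (+ 1 +ℤ (+ 1 +ℤ x)) ≡ (j -ℤ + 1) -ℤ (+ 1 +ℤ x)
  identity = solve-∀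

-suc-swap : ∀ j k m → (j -ℤ + (2 + m)) -ℤ + suc k ≡ (j -ℤ + (2 + k)) -ℤ + suc m
-suc-swap j k m = identity j (+ m) (+ k)
  where
  identity : ∀ (j x y : ℤ) → (j -ℤ (+ 1 +ℤ (+ 1 +ℤ x))) -ℤ (+ 1 +ℤ y) ≡ (j -ℤ (+ 1 +ℤ (+ 1 +ℤ y))) -ℤ (+ 1 +ℤ x)
  identity = solve-∀

pascal₂ : ∀ k m j → gaussℤ (suc k) (suc m) j ≡ gaussℤ k (suc m) j + gaussℤ (suc k) m (j -ℤ + suc k)
pascal₂ zero zero j = begin
  gaussℤ 1 1 j                                   ≡⟨ pascal₁ 0 0 j ⟩
  gaussℤ 1 0 j + gaussℤ 0 1 (j -ℤ + 1)
    ≡⟨ cong₂ _+_ (trans (gaussℤ-noSize 1 j) (sym (gaussℤ-noParts 1 j)))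
                 (trans (gaussℤ-noParts 1 (j -ℤ + 1)) (sym (gaussℤ-noSize 1 (j -ℤ + 1)))) ⟩
  gaussℤ 0 1 j + gaussℤ 1 0 (j -ℤ + 1)            ∎
pascal₂ zero (suc m) j = begin
  gaussℤ 1 (2 + m) j                             ≡⟨ pascal₁ 0 (suc m) j ⟩
  gaussℤ 1 (suc m) j + gaussℤ 0 (2 + m) (j -ℤ + (2 + m))
    ≡⟨ cong (_+ gaussℤ 0 (2 + m) (j -ℤ + (2 + m))) (pascal₂ 0 m j) ⟩
  (gaussℤ 0 (suc m) j + gaussℤ 1 m (j -ℤ + 1)) + gaussℤ 0 (2 + m) (j -ℤ + (2 + m))
    ≡⟨ ℕₚ.+-assoc (gaussℤ 0 (suc m) j) _ _ ⟩
  gaussℤ 0 (suc m) j + (gaussℤ 1 m (j -ℤ + 1) + gaussℤ 0 (2 + m) (j -ℤ + (2 + m)))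
    ≡⟨ cong₂ _+_ (trans (gaussℤ-noParts _ j) (sym (gaussℤ-noParts _ j)))
                 (cong (_+_ (gaussℤ 1 m (j -ℤ + 1)))
                       (trans (gaussℤ-noParts _ _) (trans (cong unitAt0 (-suc-split j m)) (sym (gaussℤ-noParts _ _))))) ⟩
  gaussℤ 0 (2 + m) j + (gaussℤ 1 m (j -ℤ + 1) + gaussℤ 0 (suc m) ((j -ℤ + 1) -ℤ + suc m))
    ≡⟨ cong (_+_ (gaussℤ 0 (2 + m) j)) (sym (pascal₁ 0 m (j -ℤ + 1))) ⟩
  gaussℤ 0 (2 + m) j + gaussℤ 1 (suc m) (j -ℤ + 1) ∎
pascal₂ (suc k) zero j = begin
  gaussℤ (2 + k) 1 j                             ≡⟨ pascal₁ (suc k) 0 j ⟩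
  gaussℤ (2 + k) 0 j + gaussℤ (suc k) 1 (j -ℤ + 1)
    ≡⟨ cong (_+_ (gaussℤ (2 + k) 0 j)) (pascal₂ k 0 (j -ℤ + 1)) ⟩
  gaussℤ (2 + k) 0 j + (gaussℤ k 1 (j -ℤ + 1) + gaussℤ (suc k) 0 ((j -ℤ + 1) -ℤ + suc k))
    ≡⟨ sym (ℕₚ.+-assoc (gaussℤ (2 + k) 0 j) _ _) ⟩
  (gaussℤ (2 + k) 0 j + gaussℤ k 1 (j -ℤ + 1)) + gaussℤ (suc k) 0 ((j -ℤ + 1) -ℤ + suc k)
    ≡⟨ cong₂ _+_ (cong (_+ gaussℤ k 1 (j -ℤ + 1)) (trans (gaussℤ-noSize _ j) (sym (gaussℤ-noSize _ j))))
                 (trans (gaussℤ-noSize _ _) (trans (cong unitAt0 (sym (-suc-split j k))) (sym (gaussℤ-noSize _ _)))) ⟩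
  (gaussℤ (suc k) 0 j + gaussℤ k 1 (j -ℤ + 1)) + gaussℤ (2 + k) 0 (j -ℤ + (2 + k))
    ≡⟨ cong (_+ gaussℤ (2 + k) 0 (j -ℤ + (2 + k))) (sym (pascal₁ k 0 j)) ⟩
  gaussℤ (suc k) 1 j + gaussℤ (2 + k) 0 (j -ℤ + (2 + k)) ∎
pascal₂ (suc k) (suc m) j = begin
  gaussℤ (2 + k) (2 + m) j                       ≡⟨ pascal₁ (suc k) (suc m) j ⟩
  gaussℤ (2 + k) (suc m) j + gaussℤ (suc k) (2 + m) (j -ℤ + (2 + m))
    ≡⟨ cong₂ _+_ (pascal₂ (suc k) m j) (pascal₂ k (suc m) (j -ℤ + (2 + m))) ⟩
  (gaussℤ (suc k) (suc m) j + gaussℤ (2 + k) m (j -ℤ + (2 + k))) +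
    (gaussℤ k (2 + m) (j -ℤ + (2 + m)) + gaussℤ (suc k) (suc m) ((j -ℤ + (2 + m)) -ℤ + suc k))
    ≡⟨ +-interchange (gaussℤ (suc k) (suc m) j) (gaussℤ (2 + k) m (j -ℤ + (2 + k))) (gaussℤ k (2 + m) (j -ℤ + (2 + m))) _ ⟩
  (gaussℤ (suc k) (suc m) j + gaussℤ k (2 + m) (j -ℤ + (2 + m))) +
    (gaussℤ (2 + k) m (j -ℤ + (2 + k)) + gaussℤ (suc k) (suc m) ((j -ℤ + (2 + m)) -ℤ + suc k))
    ≡⟨ cong (λ z → (gaussℤ (suc k) (suc m) j + gaussℤ k (2 + m) (j -ℤ + (2 + m))) +
                   (gaussℤ (2 + k) m (j -ℤ + (2 + k)) + gaussℤ (suc k) (suc m) z)) (-suc-swap j k m) ⟩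
  (gaussℤ (suc k) (suc m) j + gaussℤ k (2 + m) (j -ℤ + (2 + m))) +
    (gaussℤ (2 + k) m (j -ℤ + (2 + k)) + gaussℤ (suc k) (suc m) ((j -ℤ + (2 + k)) -ℤ + suc m))
    ≡⟨ cong₂ _+_ (sym (pascal₁ k (suc m) j)) (sym (pascal₁ (suc k) m (j -ℤ + (2 + k)))) ⟩
  gaussℤ (suc k) (2 + m) j + gaussℤ (2 + k) (suc m) (j -ℤ + (2 + k)) ∎

-- Symmetry: complementing partitions inside the k × m box.
gaussℤ-sym : ∀ k m j → gaussℤ k m j ≡ gaussℤ k m (+ (k * m) -ℤ j)
gaussℤ-sym zero m j = trans (gaussℤ-noParts m j) (trans (unitAt0-neg j) (sym (gaussℤ-noParts m _)))
gaussℤ-sym (suc k) zero j = trans (gaussℤ-noSize _ j) (trans (unitAt0-neg j)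
  (trans (cong (λ n → unitAt0 (+ n -ℤ j)) (sym (ℕₚ.*-zeroʳ (suc k)))) (sym (gaussℤ-noSize _ _))))
gaussℤ-sym (suc k) (suc m) j = begin
  gaussℤ (suc k) (suc m) j                       ≡⟨ pascal₁ k m j ⟩
  gaussℤ (suc k) m j + gaussℤ k (suc m) (j -ℤ + suc m)
    ≡⟨ cong₂ _+_ (gaussℤ-sym (suc k) m j) (gaussℤ-sym k (suc m) (j -ℤ + suc m)) ⟩
  gaussℤ (suc k) m (+ (suc k * m) -ℤ j) + gaussℤ k (suc m) (+ (k * suc m) -ℤ (j -ℤ + suc m))
    ≡⟨ ℕₚ.+-comm (gaussℤ (suc k) m (+ (suc k * m) -ℤ j)) _ ⟩
  gaussℤ k (suc m) (+ (k * suc m) -ℤ (j -ℤ + suc m)) + gaussℤ (suc k) m (+ (suc k * m) -ℤ j)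
    ≡⟨ cong₂ _+_ (cong (gaussℤ k (suc m)) complement₁) (cong (gaussℤ (suc k) m) complement₂) ⟩
  gaussℤ k (suc m) J + gaussℤ (suc k) m (J -ℤ + suc k) ≡⟨ sym (pascal₂ k m J) ⟩
  gaussℤ (suc k) (suc m) J                       ∎
  where
  J : ℤ
  J = + (suc k * suc m) -ℤ j
  complement₁ : + (k * suc m) -ℤ (j -ℤ + suc m) ≡ J
  complement₁ = begin
    + (k * suc m) -ℤ (j -ℤ + suc m)          ≡⟨ cong (_-ℤ (j -ℤ + suc m)) (ℤₚ.pos-* k (suc m)) ⟩
    + k *ℤ (+ 1 +ℤ + m) -ℤ (j -ℤ (+ 1 +ℤ + m)) ≡⟨ identity j (+ k) (+ m) ⟩
    (+ 1 +ℤ + k) *ℤ (+ 1 +ℤ + m) -ℤ j       ≡⟨ cong (_-ℤ j) (sym (ℤₚ.pos-* (suc k) (suc m))) ⟩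
    J                                       ∎
    where
    identity : ∀ (j k m : ℤ) → k *ℤ (+ 1 +ℤ m) -ℤ (j -ℤ (+ 1 +ℤ m)) ≡ (+ 1 +ℤ k) *ℤ (+ 1 +ℤ m) -ℤ j
    identity = solve-∀
  complement₂ : + (suc k * m) -ℤ j ≡ J -ℤ + suc k
  complement₂ = begin
    + (suc k * m) -ℤ j                       ≡⟨ cong (_-ℤ j) (ℤₚ.pos-* (suc k) m) ⟩
    (+ 1 +ℤ + k) *ℤ + m -ℤ j                 ≡⟨ identity j (+ k) (+ m) ⟩
    ((+ 1 +ℤ + k) *ℤ (+ 1 +ℤ + m) -ℤ j) -ℤ (+ 1 +ℤ + k) ≡⟨ cong (λ n → (n -ℤ j) -ℤ + suc k) (sym (ℤₚ.pos-* (suc k) (suc m))) ⟩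
    J -ℤ + suc k                             ∎
    where
    identity : ∀ (j k m : ℤ) → (+ 1 +ℤ k) *ℤ m -ℤ j ≡ ((+ 1 +ℤ k) *ℤ (+ 1 +ℤ m) -ℤ j) -ℤ (+ 1 +ℤ k)
    identity = solve-∀

-- Only the empty partition has size 0.
gaussℤ-at0 : ∀ k m → gaussℤ k m (+ 0) ≡ 1
gaussℤ-at0 zero    m       = refl
gaussℤ-at0 (suc k) zero    = gaussℤ-noSize (suc k) (+ 0)
gaussℤ-at0 (suc k) (suc m) = trans (pascal₁ k m (+ 0)) (cong (_+ gaussℤ k (suc m) (+ 0 -ℤ + suc m)) (gaussℤ-at0 (suc k) m))

partsBelow : ℕ → ℕ → ℕ
partsBelow a       zero    = parts23 a
partsBelow zero    (suc c) = 0
partsBelow (suc a) (suc c) = partsBelow a c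

Y-at0 : ∀ a → Y a 0 ≡ 0
Y-at0 zero          = refl
Y-at0 (suc zero)    = refl
Y-at0 (suc (suc a)) = refl

shift₂₂-at1 : ∀ F a → shift₂₂ F a 1 ≡ 0
shift₂₂-at1 F zero          = refl
shift₂₂-at1 F (suc zero)    = refl
shift₂₂-at1 F (suc (suc a)) = refl

shift₂₂-at0 : ∀ F a → shift₂₂ F a 0 ≡ 0
shift₂₂-at0 F zero          = refl
shift₂₂-at0 F (suc zero)    = refl
shift₂₂-at0 F (suc (suc a)) = refl

rhsCoeff-at0 : ∀ a → rhsCoeff a 0 ≡ parts23 a
rhsCoeff-at0 a = trans (cong (_+_ (parts23 a)) (Y-at0 a)) (ℕₚ.+-identityʳ _)

rhsCoeff-at1 : ∀ a → rhsCoeff a 1 ≡ 0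
rhsCoeff-at1 zero    = refl
rhsCoeff-at1 (suc a) rewrite shift₂₂-at1 X (suc a) | Y-at0 a = refl

Y-step : ∀ a c → Y (suc a) (suc (suc c)) ≡ Y a c + partsBelow (suc a) (suc (suc c))
Y-step zero    c       = refl
Y-step (suc a) zero    rewrite shift₂₂-at1 X (suc a) | Y-at0 a | shift₂₂-at0 X (suc a) = ℕₚ.+-identityʳ _
Y-step (suc a) (suc c) = begin
  X a (suc c) + Y (suc a) (suc (suc c))       ≡⟨ cong₂ _+_ (X-shift a c) (Y-step a c) ⟩
  shift₂₂ X (suc a) (suc c) + (Y a c + partsBelow (suc a) (suc (suc c)))
    ≡⟨ sym (ℕₚ.+-assoc (shift₂₂ X (suc a) (suc c)) _ _) ⟩
  (shift₂₂ X (suc a) (suc c) + Y a c) + partsBelow (suc a) (suc (suc c)) ∎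
  where
  X-shift : ∀ a c → X a (suc c) ≡ shift₂₂ X (suc a) (suc c)
  X-shift a       zero    = sym (shift₂₂-at1 X (suc a))
  X-shift zero    (suc c) = refl
  X-shift (suc a) (suc c) = refl

rhsCoeff-step : ∀ a c → rhsCoeff (suc a) (suc (suc c)) ≡ rhsCoeff a c + partsBelow (suc a) (suc (suc c))
rhsCoeff-step a c = trans (cong (_+_ (X a c)) (Y-step a c)) (sym (ℕₚ.+-assoc (X a c) _ _))

-- First differences Δ k m j = g(j) - g(j-1) of the coefficients g = gaussℤ k m,
-- i.e. the coefficients of (1 - q) [m+k choose k]_q.

Δ : ℕ → ℕ → ℤ → ℤ
Δ k m j = + gaussℤ k m j -ℤ + gaussℤ k m (j -ℤ + 1)

-- Both Pascal rules are linear, so they pass to the differences.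

difference-of-sums : ∀ (a b c d : ℤ) → (a +ℤ b) -ℤ (c +ℤ d) ≡ (a -ℤ c) +ℤ (b -ℤ d)
difference-of-sums = solve-∀

-1-comm : ∀ (j x : ℤ) → (j -ℤ + 1) -ℤ x ≡ (j -ℤ x) -ℤ + 1
-1-comm = solve-∀

Δ-pascal₁ : ∀ k m j → Δ (suc k) (suc m) j ≡ Δ (suc k) m j +ℤ Δ k (suc m) (j -ℤ + suc m)
Δ-pascal₁ k m j = trans
  (cong₂ _-ℤ_ (cong +_ (pascal₁ k m j))
              (cong +_ (trans (pascal₁ k m (j -ℤ + 1)) (cong (λ z → gaussℤ (suc k) m (j -ℤ + 1) + gaussℤ k (suc m) z) (-1-comm j (+ suc m))))))
  (difference-of-sums (+ gaussℤ (suc k) m j) (+ gaussℤ k (suc m) (j -ℤ + suc m))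
                      (+ gaussℤ (suc k) m (j -ℤ + 1)) (+ gaussℤ k (suc m) ((j -ℤ + suc m) -ℤ + 1)))

Δ-pascal₂ : ∀ k m j → Δ (suc k) (suc m) j ≡ Δ k (suc m) j +ℤ Δ (suc k) m (j -ℤ + suc k)
Δ-pascal₂ k m j = trans
  (cong₂ _-ℤ_ (cong +_ (pascal₂ k m j))
              (cong +_ (trans (pascal₂ k m (j -ℤ + 1)) (cong (λ z → gaussℤ k (suc m) (j -ℤ + 1) + gaussℤ (suc k) m z) (-1-comm j (+ suc k))))))
  (difference-of-sums (+ gaussℤ k (suc m) j) (+ gaussℤ (suc k) m (j -ℤ + suc k))
                      (+ gaussℤ k (suc m) (j -ℤ + 1)) (+ gaussℤ (suc k) m ((j -ℤ + suc k) -ℤ + 1)))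

-- Symmetry of the coefficients makes the differences antisymmetric about km/2.
Δ-antisym : ∀ k m j → Δ k m j ≡ -ℤ Δ k m ((+ (k * m) -ℤ j) +ℤ + 1)
Δ-antisym k m j = begin
  + gaussℤ k m j -ℤ + gaussℤ k m (j -ℤ + 1)
    ≡⟨ cong₂ _-ℤ_ (cong +_ (gaussℤ-sym k m j))
                  (cong +_ (trans (gaussℤ-sym k m (j -ℤ + 1)) (cong (gaussℤ k m) (reflect (+ (k * m)) j)))) ⟩
  + gaussℤ k m J -ℤ + gaussℤ k m (J +ℤ + 1)       ≡⟨ negate (+ gaussℤ k m J) (+ gaussℤ k m (J +ℤ + 1)) ⟩
  -ℤ (+ gaussℤ k m (J +ℤ + 1) -ℤ + gaussℤ k m J)  ≡⟨ cong (λ z → -ℤ (+ gaussℤ k m (J +ℤ + 1) -ℤ + gaussℤ k m z)) (sym (+1-1 J)) ⟩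
  -ℤ (+ gaussℤ k m (J +ℤ + 1) -ℤ + gaussℤ k m ((J +ℤ + 1) -ℤ + 1)) ∎
  where
  J : ℤ
  J = + (k * m) -ℤ j
  reflect : ∀ (n j : ℤ) → n -ℤ (j -ℤ + 1) ≡ (n -ℤ j) +ℤ + 1
  reflect = solve-∀
  negate : ∀ (a b : ℤ) → a -ℤ b ≡ -ℤ (b -ℤ a)
  negate = solve-∀
  +1-1 : ∀ (x : ℤ) → (x +ℤ + 1) -ℤ + 1 ≡ x
  +1-1 = solve-∀

-- (1 - q)[m+2 choose 2]_q = (1 - q^(m+1))(1 - q^(m+2))/(1 - q²): its middle
-- coefficient (at q^m) is [m even].
Δ₂-middle : ∀ m → Δ 2 m (+ m) ≡ + isEven m
Δ₂-middle zero    = refl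
Δ₂-middle (suc m) = begin
  Δ 2 (suc m) (+ suc m)                           ≡⟨ Δ-pascal₁ 1 m (+ suc m) ⟩
  Δ 2 m (+ suc m) +ℤ Δ 1 (suc m) (+ suc m -ℤ + suc m)
    ≡⟨ cong₂ _+ℤ_ (Δ-antisym 2 m (+ suc m)) (cong (Δ 1 (suc m)) (ℤₚ.+-inverseʳ (+ suc m))) ⟩
  -ℤ Δ 2 m ((+ (2 * m) -ℤ + suc m) +ℤ + 1) +ℤ Δ 1 (suc m) (+ 0)
    ≡⟨ cong (λ z → -ℤ Δ 2 m z +ℤ Δ 1 (suc m) (+ 0)) (trans (cong (λ z → (z -ℤ + suc m) +ℤ + 1) (ℤₚ.pos-* 2 m)) (mirror (+ m))) ⟩
  -ℤ Δ 2 m (+ m) +ℤ Δ 1 (suc m) (+ 0)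
    ≡⟨ cong₂ (λ u v → -ℤ u +ℤ (+ v -ℤ + 0)) (Δ₂-middle m) (gaussℤ-at0 1 (suc m)) ⟩
  -ℤ (+ isEven m) +ℤ (+ 1 -ℤ + 0)                 ≡⟨ alternate m ⟩
  + isEven (suc m)                               ∎
  where
  mirror : ∀ (x : ℤ) → (+ 2 *ℤ x -ℤ (+ 1 +ℤ x)) +ℤ + 1 ≡ x
  mirror = solve-∀
  alternate : ∀ m → -ℤ (+ isEven m) +ℤ (+ 1 -ℤ + 0) ≡ + isEven (suc m)
  alternate zero          = refl
  alternate (suc zero)    = refl
  alternate (suc (suc m)) = alternate m

-ℤ-suc : ∀ a c → + suc a -ℤ + suc c ≡ + a -ℤ + c
-ℤ-suc a c = identity (+ a) (+ c)
  where
  identity : ∀ (x y : ℤ) → (+ 1 +ℤ x) -ℤ (+ 1 +ℤ y) ≡ x -ℤ y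
  identity = solve-∀

parts23ℤ : ℤ → ℤ
parts23ℤ (+ n)    = + parts23 n
parts23ℤ -[1+ _ ] = + 0

parts23ℤ-partsBelow : ∀ a c → parts23ℤ (+ a -ℤ + c) ≡ + partsBelow a c
parts23ℤ-partsBelow a       zero    = cong parts23ℤ (ℤₚ.+-identityʳ (+ a))
parts23ℤ-partsBelow zero    (suc c) = refl
parts23ℤ-partsBelow (suc a) (suc c) = trans (cong parts23ℤ (-ℤ-suc a c)) (parts23ℤ-partsBelow a c)

-- (1 - q)[a+3 choose 3]_q = (1 - q^(a+1))(1 - q^(a+2))(1 - q^(a+3))/((1 - q²)(1 - q³)):
-- up to degree a its coefficients are those of 1/((1 - q²)(1 - q³)).
Δ₃-low : ∀ a c → Δ 3 a (+ a -ℤ + c) ≡ parts23ℤ (+ a -ℤ + c)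
Δ₃-low zero    zero    = refl
Δ₃-low zero    (suc c) = refl
Δ₃-low (suc a) zero    = begin
  Δ 3 (suc a) (+ suc a -ℤ + 0)                    ≡⟨ cong (Δ 3 (suc a)) (ℤₚ.+-identityʳ (+ suc a)) ⟩
  Δ 3 (suc a) (+ suc a)                          ≡⟨ Δ-pascal₂ 2 a (+ suc a) ⟩
  Δ 2 (suc a) (+ suc a) +ℤ Δ 3 a (+ suc a -ℤ + 3)
    ≡⟨ cong₂ _+ℤ_ (Δ₂-middle (suc a)) (trans (cong (Δ 3 a) (-ℤ-suc a 2)) (Δ₃-low a 2)) ⟩
  + isEven (suc a) +ℤ parts23ℤ (+ a -ℤ + 2)       ≡⟨ parts23-step a ⟩
  parts23ℤ (+ suc a)                             ≡⟨ cong parts23ℤ (sym (ℤₚ.+-identityʳ (+ suc a))) ⟩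
  parts23ℤ (+ suc a -ℤ + 0)                       ∎
  where
  parts23-step : ∀ a → + isEven (suc a) +ℤ parts23ℤ (+ a -ℤ + 2) ≡ parts23ℤ (+ suc a)
  parts23-step zero          = refl
  parts23-step (suc zero)    = refl
  parts23-step (suc (suc a)) = refl
Δ₃-low (suc a) (suc c) = begin
  Δ 3 (suc a) (+ suc a -ℤ + suc c)                ≡⟨ cong (Δ 3 (suc a)) (-ℤ-suc a c) ⟩
  Δ 3 (suc a) (+ a -ℤ + c)                        ≡⟨ Δ-pascal₁ 2 a (+ a -ℤ + c) ⟩
  Δ 3 a (+ a -ℤ + c) +ℤ Δ 2 (suc a) ((+ a -ℤ + c) -ℤ + suc a)
    ≡⟨ cong (λ z → Δ 3 a (+ a -ℤ + c) +ℤ Δ 2 (suc a) z) (below (+ a) (+ c)) ⟩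
  Δ 3 a (+ a -ℤ + c) +ℤ Δ 2 (suc a) -[1+ c ]      ≡⟨ ℤₚ.+-identityʳ _ ⟩
  Δ 3 a (+ a -ℤ + c)                              ≡⟨ Δ₃-low a c ⟩
  parts23ℤ (+ a -ℤ + c)                           ≡⟨ cong parts23ℤ (sym (-ℤ-suc a c)) ⟩
  parts23ℤ (+ suc a -ℤ + suc c)                   ∎
  where
  below : ∀ (x y : ℤ) → (x -ℤ y) -ℤ (+ 1 +ℤ x) ≡ -ℤ (+ 1 +ℤ y)
  below = solve-∀

-- Induction on a: the first Pascal rule adds
-- Δ₃ (a+1), which is partsBelow (a+1) c in this range; the rows c = 0, 1 come
-- from antisymmetry about the middle.
Δ₄-middle : ∀ a c → Δ 4 a (+ (2 * a) -ℤ + c) ≡ + rhsCoeff a c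
Δ₄-middle zero    zero          = refl
Δ₄-middle zero    (suc zero)    = refl
Δ₄-middle zero    (suc (suc c)) = refl
Δ₄-middle (suc a) c = begin
  Δ 4 (suc a) j                                  ≡⟨ Δ-pascal₁ 3 a j ⟩
  Δ 4 a j +ℤ Δ 3 (suc a) (j -ℤ + suc a)
    ≡⟨ cong (Δ 4 a j +ℤ_) (trans (cong (Δ 3 (suc a)) (half (+ a) (+ c)))
                                  (trans (Δ₃-low (suc a) c) (parts23ℤ-partsBelow (suc a) c))) ⟩
  Δ 4 a j +ℤ + partsBelow (suc a) c               ≡⟨ next c ⟩
  + rhsCoeff (suc a) c                           ∎
  where
  j : ℤ
  j = + (2 * suc a) -ℤ + c
  ih : ∀ c → Δ 4 a (+ (2 * a) -ℤ + c) ≡ + rhsCoeff a c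
  ih = Δ₄-middle a
  half : ∀ (x y : ℤ) → (+ 2 *ℤ (+ 1 +ℤ x) -ℤ y) -ℤ (+ 1 +ℤ x) ≡ (+ 1 +ℤ x) -ℤ y
  half = solve-∀
  -- reflection about the middle 2a of the degree range [0, 4a]
  reflect : ∀ (x y : ℤ) → (+ 4 *ℤ x -ℤ (+ 2 *ℤ (+ 1 +ℤ x) -ℤ y)) +ℤ + 1 ≡ + 2 *ℤ x -ℤ (+ 1 -ℤ y)
  reflect = solve-∀
  mirrored : ∀ c → Δ 4 a (+ (2 * suc a) -ℤ + c) ≡ -ℤ Δ 4 a (+ (2 * a) -ℤ (+ 1 -ℤ + c))
  mirrored c = trans (Δ-antisym 4 a (+ (2 * suc a) -ℤ + c))
    (cong (λ z → -ℤ Δ 4 a z)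
      (trans (cong₂ (λ u v → (u -ℤ (v -ℤ + c)) +ℤ + 1) (ℤₚ.pos-* 4 a) (ℤₚ.pos-* 2 (suc a)))
             (trans (reflect (+ a) (+ c)) (cong (_-ℤ (+ 1 -ℤ + c)) (sym (ℤₚ.pos-* 2 a))))))
  shift2 : ∀ (x y : ℤ) → + 2 *ℤ (+ 1 +ℤ x) -ℤ (+ 1 +ℤ (+ 1 +ℤ y)) ≡ + 2 *ℤ x -ℤ y
  shift2 = solve-∀
  next : ∀ c → Δ 4 a (+ (2 * suc a) -ℤ + c) +ℤ + partsBelow (suc a) c ≡ + rhsCoeff (suc a) c
  next zero = begin
    Δ 4 a (+ (2 * suc a) -ℤ + 0) +ℤ + parts23 (suc a)
      ≡⟨ cong (_+ℤ + parts23 (suc a)) (trans (mirrored 0) (cong -ℤ_ (trans (ih 1) (cong +_ (rhsCoeff-at1 a))))) ⟩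
    + parts23 (suc a)                            ≡⟨ cong +_ (sym (rhsCoeff-at0 (suc a))) ⟩
    + rhsCoeff (suc a) 0                         ∎
  next (suc zero) = begin
    Δ 4 a (+ (2 * suc a) -ℤ + 1) +ℤ + parts23 a
      ≡⟨ cong (_+ℤ + parts23 a) (trans (mirrored 1) (cong -ℤ_ (trans (ih 0) (cong +_ (rhsCoeff-at0 a))))) ⟩
    -ℤ (+ parts23 a) +ℤ + parts23 a               ≡⟨ ℤₚ.+-inverseˡ (+ parts23 a) ⟩
    + 0                                          ≡⟨ cong +_ (sym (rhsCoeff-at1 (suc a))) ⟩
    + rhsCoeff (suc a) 1                         ∎
  next (suc (suc c)) = begin
    Δ 4 a (+ (2 * suc a) -ℤ + suc (suc c)) +ℤ + partsBelow (suc a) (suc (suc c))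
      ≡⟨ cong (_+ℤ + partsBelow (suc a) (suc (suc c)))
              (trans (cong (Δ 4 a) (trans (cong (_-ℤ + suc (suc c)) (ℤₚ.pos-* 2 (suc a)))
                                           (trans (shift2 (+ a) (+ c)) (cong (_-ℤ + c) (sym (ℤₚ.pos-* 2 a))))))
                     (ih c)) ⟩
    + (rhsCoeff a c + partsBelow (suc a) (suc (suc c))) ≡⟨ cong +_ (sym (rhsCoeff-step a c)) ⟩
    + rhsCoeff (suc a) (suc (suc c))             ∎

dℤ-gaussℤ : ∀ a j → dℤ a j ≡ + gaussℤ 4 a j
dℤ-gaussℤ a (+ n)    = refl
dℤ-gaussℤ a -[1+ n ] = refl

f-closed : ∀ a c → f a (+ c) ≡ + rhsCoeff a c
f-closed a c = trans (cong₂ _-ℤ_ (dℤ-gaussℤ a j) (dℤ-gaussℤ a (j -ℤ + 1))) (Δ₄-middle a c)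
  where
  j : ℤ
  j = + (2 * a) -ℤ + c

partsBelow-above : ∀ a c → a < c → partsBelow a c ≡ 0
partsBelow-above zero    (suc c) _         = refl
partsBelow-above (suc a) (suc c) (s≤s a<c) = partsBelow-above a c a<c

2*suc : ∀ a → 2 * suc a ≡ suc (suc (2 * a))
2*suc a = cong suc (ℕₚ.+-suc a (a + 0))

rhsCoeff-2a-1 : ∀ a → rhsCoeff (suc a) (suc (2 * a)) ≡ 0
rhsCoeff-2a-1 zero    = refl
rhsCoeff-2a-1 (suc a) = begin
  rhsCoeff (suc (suc a)) (suc (2 * suc a))        ≡⟨ cong (λ n → rhsCoeff (suc (suc a)) (suc n)) (2*suc a) ⟩
  rhsCoeff (suc (suc a)) (suc (suc (suc (2 * a)))) ≡⟨ rhsCoeff-step (suc a) (suc (2 * a)) ⟩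
  rhsCoeff (suc a) (suc (2 * a)) + partsBelow (suc (suc a)) (suc (suc (suc (2 * a))))
    ≡⟨ cong₂ _+_ (rhsCoeff-2a-1 a) (partsBelow-above a (suc (2 * a)) (s≤s (ℕₚ.m≤m+n a (a + 0)))) ⟩
  0                                              ∎

parts23-zero : ∀ a → parts23 a ≡ 0 → a ≡ 1
parts23-zero zero ()
parts23-zero (suc zero) _ = refl
parts23-zero (suc (suc zero)) ()
parts23-zero (suc (suc (suc n))) e with parts23-zero n (ℕₚ.m+n≡0⇒n≡0 (isEven (suc n)) e)
... | refl with e
... | ()

-- The zero pattern of part (b); for a = 1 the coefficient at c = 0 vanishes as well.
Exceptional : ℕ → ℕ → Set
Exceptional a c = c ≡ 1 ⊎ c ≡ 2 * a ∸ 1 ⊎ (a ≡ 4 × c ≡ 3)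

ZeroPattern : ℕ → ℕ → Set
ZeroPattern a c = Exceptional a c ⊎ (a ≡ 1 × c ≡ 0)

-- A zero at (a+1, c+2) forces zeros of rhsCoeff at (a, c) and of partsBelow at
-- (a, c+1) (by rhsCoeff-step); from a zero at (a, c) the latter only allows
-- continuing to (2, 3), (4, 3) or along c = 2a - 1.
zeros-step : ∀ a c → rhsCoeff a c ≡ 0 → partsBelow a (suc c) ≡ 0 → c ≤ 2 * a → ZeroPattern a c → ZeroPattern (suc a) (suc (suc c))
zeros-step zero                .1 _ _  ()  (inj₁ (inj₁ refl))
zeros-step (suc zero)          .1 _ _  _   (inj₁ (inj₁ refl)) = inj₁ (inj₂ (inj₁ refl))
zeros-step (suc (suc zero))    .1 _ () _   (inj₁ (inj₁ refl))
zeros-step (suc (suc (suc n))) .1 _ p0 _   (inj₁ (inj₁ refl)) with parts23-zero (suc n) p0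
... | refl = inj₁ (inj₂ (inj₂ (refl , refl)))
zeros-step zero                .0 () _ _   (inj₁ (inj₂ (inj₁ refl)))
zeros-step (suc a) c           _ _  _      (inj₁ (inj₂ (inj₁ c≡))) = inj₁ (inj₂ (inj₁ (begin
  suc (suc c)                    ≡⟨ cong (λ n → suc (suc n)) c≡ ⟩
  suc (suc (2 * suc a ∸ 1))      ≡⟨ cong (λ n → suc (suc (n ∸ 1))) (2*suc a) ⟩
  suc (suc (suc (2 * a)))        ≡⟨ cong suc (sym (2*suc a)) ⟩
  suc (2 * suc a)                ≡⟨ cong (_∸ 1) (sym (2*suc (suc a))) ⟩
  2 * suc (suc a) ∸ 1            ∎)))
zeros-step .4 .3 _ () _ (inj₁ (inj₂ (inj₂ (refl , refl))))
zeros-step .1 .0 _ () _ (inj₂ (refl , refl))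

rhsCoeff-zeros : ∀ a c → rhsCoeff a c ≡ 0 → c ≤ 2 * a → ZeroPattern a c
rhsCoeff-zeros a       zero          z _    = inj₂ (parts23-zero a (trans (sym (rhsCoeff-at0 a)) z) , refl)
rhsCoeff-zeros a       (suc zero)    z _    = inj₁ (inj₁ refl)
rhsCoeff-zeros zero    (suc (suc c)) z ()
rhsCoeff-zeros (suc a) (suc (suc c)) z c+2≤ =
  zeros-step a c z₁ (ℕₚ.m+n≡0⇒n≡0 (rhsCoeff a c) z′) c≤ (rhsCoeff-zeros a c z₁ c≤)
  where
  z′ : rhsCoeff a c + partsBelow (suc a) (suc (suc c)) ≡ 0
  z′ = trans (sym (rhsCoeff-step a c)) z
  z₁ : rhsCoeff a c ≡ 0
  z₁ = ℕₚ.m+n≡0⇒m≡0 (rhsCoeff a c) z′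
  c≤ : c ≤ 2 * a
  c≤ = ℕₚ.≤-pred (ℕₚ.≤-pred (subst (suc (suc c) ≤_) (2*suc a) c+2≤))

rhsCoeff-exceptional : ∀ a c → 2 ≤ a → Exceptional a c → rhsCoeff a c ≡ 0
rhsCoeff-exceptional a       .1 _ (inj₁ refl)                  = rhsCoeff-at1 a
rhsCoeff-exceptional (suc a) c  _ (inj₂ (inj₁ refl))           = trans (cong (λ n → rhsCoeff (suc a) (n ∸ 1)) (2*suc a)) (rhsCoeff-2a-1 a)
rhsCoeff-exceptional .4      .3 _ (inj₂ (inj₂ (refl , refl))) = refl

-- parts23 grows by one every 6 steps: unfolding the recurrence twice,
-- parts23 (n + 6) = [n even] + [n + 1 even] + parts23 n.
parts23-+6 : ∀ n → parts23 (6 + n) ≡ suc (parts23 n)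
parts23-+6 n = trans (sym (ℕₚ.+-assoc (isEven n) (isEven (suc n)) (parts23 n))) (cong (_+ parts23 n) (isEven-alternates n))
  where
  isEven-alternates : ∀ n → isEven n + isEven (suc n) ≡ 1
  isEven-alternates zero          = refl
  isEven-alternates (suc zero)    = refl
  isEven-alternates (suc (suc n)) = isEven-alternates n

δ-+6 : ∀ a → δ (6 + a) ≡ δ a
δ-+6 a = cong (λ r → if r ≡ᵇ 1 then 1 else 2) (trans (cong (_% 2) (ℕₚ.+-comm 6 a)) ([m+kn]%n≡m%n a 3 2))

parts23-floor : ∀ a → parts23 a ≡ (a + 3 * δ a) / 6
parts23-floor zero                                     = refl
parts23-floor (suc zero)                               = refl
parts23-floor (suc (suc zero))                         = refl
parts23-floor (suc (suc (suc zero)))                   = refl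
parts23-floor (suc (suc (suc (suc zero))))             = refl
parts23-floor (suc (suc (suc (suc (suc zero)))))       = refl
parts23-floor (suc (suc (suc (suc (suc (suc a)))))) = begin
  parts23 (6 + a)                  ≡⟨ parts23-+6 a ⟩
  suc (parts23 a)                  ≡⟨ cong suc (parts23-floor a) ⟩
  suc ((a + 3 * δ a) / 6)          ≡⟨ cong (λ n → suc (n / 6)) (sym (ℕₚ.m+n∸m≡n 6 (a + 3 * δ a))) ⟩
  suc ((6 + (a + 3 * δ a) ∸ 6) / 6) ≡⟨ sym (m/n≡1+[m∸n]/n {6 + (a + 3 * δ a)} {6} (ℕₚ.m≤m+n 6 _)) ⟩
  (6 + (a + 3 * δ a)) / 6          ≡⟨ cong (λ d → (6 + a + 3 * d) / 6) (sym (δ-+6 a)) ⟩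
  (6 + a + 3 * δ (6 + a)) / 6      ∎

parts23-unbounded : ∀ M r → M ≤ parts23 (6 * M + r)
parts23-unbounded zero    r = z≤n
parts23-unbounded (suc M) r = subst (suc M ≤_) (sym step) (s≤s (parts23-unbounded M r))
  where
  step : parts23 (6 * suc M + r) ≡ suc (parts23 (6 * M + r))
  step = trans (cong (λ n → parts23 (n + r)) (ℕₚ.*-suc 6 M))
               (trans (cong parts23 (ℕₚ.+-assoc 6 (6 * M) r)) (parts23-+6 (6 * M + r)))

f-nonneg : ∀ a c → + 0 ≤ℤ f a c
f-nonneg a (+ c)    = subst (+ 0 ≤ℤ_) (sym (f-closed a c)) (+≤+ z≤n)
f-nonneg a -[1+ c ] = +≤+ z≤n

f-zeros : ∀ a c → 2 ≤ a → c ≤ 2 * a → f a (+ c) ≡ + 0 ⇔ Exceptional a c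
f-zeros a c 2≤a c≤2a = mk⇔ to from
  where
  to : f a (+ c) ≡ + 0 → Exceptional a c
  to f≡0 with rhsCoeff-zeros a c (ℤₚ.+-injective (trans (sym (f-closed a c)) f≡0)) c≤2a
  ... | inj₁ exceptional = exceptional
  ... | inj₂ (refl , refl) = ⊥-elim (ℕₚ.<-irrefl refl 2≤a)
  from : Exceptional a c → f a (+ c) ≡ + 0
  from exceptional = trans (f-closed a c) (cong +_ (rhsCoeff-exceptional a c 2≤a exceptional))

f-at0 : ∀ a → f a (+ 0) ≡ + ((a + 3 * δ a) / 6)
f-at0 a = trans (f-closed a 0) (cong +_ (trans (rhsCoeff-at0 a) (parts23-floor a)))

f-at0-unbounded : ∀ M → ∃ λ N → ∀ a → N ≤ a → + M ≤ℤ f a (+ 0)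
f-at0-unbounded M = 6 * M , λ a 6M≤a →
  subst (+ M ≤ℤ_) (sym (trans (f-closed a 0) (cong +_ (rhsCoeff-at0 a))))
        (+≤+ (subst (M ≤_) (cong parts23 (ℕₚ.m+[n∸m]≡n 6M≤a)) (parts23-unbounded M (a ∸ 6 * M))))

lemma2p1 :
      ((a c : ℕ) → fSeries a c ≡ rhsA a c)
    × ((a : ℕ) (c : ℤ) → + 0 ≤ℤ f a c)
    × ((a c : ℕ) → 2 ≤ a → c ≤ 2 * a →
         (f a (+ c) ≡ + 0 ⇔ (c ≡ 1 ⊎ c ≡ 2 * a ∸ 1 ⊎ (a ≡ 4 × c ≡ 3))))
    × ((a : ℕ) → f a (+ 0) ≡ + ((a + 3 * δ a) / 6))
    × ((M : ℕ) → ∃ λ N → (a : ℕ) → N ≤ a → + M ≤ℤ f a (+ 0))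
lemma2p1 =
    (λ a c → trans (f-closed a c) (sym (rhsA-coeff a c)))
  , f-nonneg
  , f-zeros
  , f-at0
  , f-at0-unbounded
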